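{- Let $n,k,m$ be integers such that $k\geq 3$, $n$ is sufficiently large, and $n/(2k^4)\leq m< n/k$. Let $0<\epsilon<1/k$ and $0<\varrho<\epsilon/12$. Let $H$ be a $k$-graph with $n$ vertices. If $\delta_1(H)\geq \binom{n-1}{k-1}-\binom{n-m}{k-1}-\varrho n^{k-1}$ and $H$ does not $\epsilon$-contain $H_k(n,m)$, then $e(H[S])\geq \frac{\epsilon n^k}{2k^2}$ for every set $S\subseteq V(H)$ with $|S|\geq \left(1-\frac{m}{n}-\frac{\epsilon}{7}\right)n$.
   Context: A $k$-graph $H$ has vertex set $V(H)$ and edge set $E(H)\subseteq\binom{V(H)}{k}$; $\delta_1(H)$ is the minimum number of edges containing a vertex; $e(\cdot)$ denotes the number of edges; $H[S]$ is the sub-hypergraph with vertex set $S$ and edges $\{e\in E(H): e\subseteq S\}$. For a partition $V=U\cup W$, $H_{k,k-1}(U,W)$ is the $k$-graph on $V$ whose edges are all $e\in\binom{V}{k}$ with $1\leq|e\cap W|\leq k-1$. A $k$-graph $H_2$ $\epsilon$-contains $H_1$ (same vertex set) if $|E(H_1)\setminus E(H_2)|\leq\epsilon|V(H_1)|^k$. An $n$-vertex $H$ $\epsilon$-contains $H_k(n,m)$ if there is a partition $V(H)=U\cup W$ with $|W|=m-1$ such that $H$ $\epsilon$-contains $H_{k,k-1}(U,W)$; otherwise it does not $\epsilon$-contain $H_k(n,m)$.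
   Formalization: The parameters ε and ϱ range over the rationals instead of the real numbers. -}

module Defs where

open import Data.Nat using (ℕ; zero; suc; _≤ᵇ_; _+_; _*_; _∸_; _^_; _≤_; _<_)
open import Data.Bool using (Bool; true; false; _∧_; not; if_then_else_)
open import Data.Fin using (Fin)
open import Data.Vec using (Vec; []; _∷_; lookup; zipWith)
open import Data.List using (List; []; _∷_; map; _++_; filter; length)
open import Data.Integer using (+_)
open import Data.Rational using (ℚ; _/_)
import Data.Rational
open import Data.Product using (Σ; _×_)
open import Relation.Binary.PropositionalEquality using (_≡_)
open import Relation.Nullary.Decidable using (yes; no)
open import Data.Bool.Properties using (T?)


-- Vertex set V = Fin n; a subset of V is a characteristic vector Vec Bool n.
Subset : ℕ → Set
Subset n = Vec Bool n

∣_∣ : ∀ {n} → Subset n → ℕ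
∣ [] ∣ = 0
∣ true ∷ s ∣ = suc ∣ s ∣
∣ false ∷ s ∣ = ∣ s ∣

_∩_ : ∀ {n} → Subset n → Subset n → Subset n
_∩_ = zipWith _∧_

_⊆ᵇ_ : ∀ {n} → Subset n → Subset n → Bool
[] ⊆ᵇ [] = true
(true ∷ a) ⊆ᵇ (false ∷ b) = false
(_ ∷ a) ⊆ᵇ (_ ∷ b) = a ⊆ᵇ b

allSubsets : (n : ℕ) → List (Subset n)
allSubsets zero = [] ∷ []
allSubsets (suc n) = map (true ∷_) (allSubsets n) ++ map (false ∷_) (allSubsets n)

count : ∀ {n} → (Subset n → Bool) → ℕ
count {n} P = length (filter (λ s → T? (P s)) (allSubsets n))

record KGraph (k n : ℕ) : Set where
  field
    edge    : Subset n → Bool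
    uniform : ∀ (e : Subset n) → edge e ≡ true → ∣ e ∣ ≡ k
open KGraph public

_≡ᵇ_ : ℕ → ℕ → Bool
zero ≡ᵇ zero = true
suc a ≡ᵇ suc b = a ≡ᵇ b
_ ≡ᵇ _ = false

deg : ∀ {k n} → KGraph k n → Fin n → ℕ
deg H v = count (λ e → edge H e ∧ lookup e v)

δ₁≥ : ∀ {k n} → KGraph k n → ℚ → Set
δ₁≥ {n = n} H d = ∀ (v : Fin n) → d Data.Rational.≤ (+ deg H v / 1)

eInduced : ∀ {k n} → KGraph k n → Subset n → ℕ
eInduced H S = count (λ e → edge H e ∧ (e ⊆ᵇ S))

-- edges of H_{k,k-1}(U,W) with U = V ∖ W: k-sets e with 1 ≤ |e ∩ W| ≤ k-1
HkEdge : ∀ {n} → ℕ → Subset n → Subset n → Bool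
HkEdge k W e = (∣ e ∣ ≡ᵇ k) ∧ ((1 ≤ᵇ ∣ e ∩ W ∣) ∧ (∣ e ∩ W ∣ ≤ᵇ (k ∸ 1)))

missing : ∀ {k n} → KGraph k n → Subset n → ℕ
missing {k} H W = count (λ e → HkEdge k W e ∧ not (edge H e))

εContainsHkk-1 : ∀ {k n} → ℚ → KGraph k n → Subset n → Set
εContainsHkk-1 {k} {n} ε H W = (+ missing H W / 1) Data.Rational.≤ ε Data.Rational.* (+ (n ^ k) / 1)

εContainsHk : ∀ {k n} → ℚ → KGraph k n → ℕ → Set
εContainsHk {n = n} ε H m = Σ (Subset n) (λ W → (∣ W ∣ ≡ m ∸ 1) × εContainsHkk-1 ε H W)

toℚ : ℕ → ℚ
toℚ n = + n / 1

-- Put the m − 1 vertices of W inside V ∖ S as far as possible, so that D = V ∖ (S ∪ W) has at most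
-- εn/7 + 1 vertices. For v ∉ W, the k-sets through v either meet W or lie in U = V ∖ W, and there are
-- C(n − m, k − 1) of the latter; together with the degree bound this shows that the k-sets through v
-- meeting W that are not edges number at most ϱn^(k−1) plus the edges of H[U] through v. Every edge
-- of H_{k,k−1}(U, W) meets U, so summing over v ∈ U bounds the edges it misses in H by
-- ϱn^k + k·e(H[U]), and e(H[U]) ≤ e(H[S]) + |D|·C(n − 1, k − 1) because an edge of H[U] leaving S
-- meets D. When e(H[S]) < εn^k/(2k²) this total is below εn^k, so H ε-contains H_k(n, m).

module Submission where

open import Algebra.Properties.CommutativeMonoid.Sum as Sum using ()
open import Data.Bool using (Bool; true; false; _∧_; not)
open import Data.Bool.Properties using (T?; T-≡; ∧-identityʳ; ∧-zeroʳ; ∧-conicalˡ; ∧-conicalʳ; not-injective)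
open import Data.Fin using (Fin; zero; suc)
open import Data.Fin.Subset using (∁; ⊤) renaming (⊥ to ∅)
open import Data.List using (List; []; _∷_; _++_; length; filter)
import Data.List as List
open import Data.List.Properties using (length-++; filter-++)
open import Data.Nat using (ℕ; zero; suc; _+_; _*_; _∸_; _^_; _≤_; _<_; _≤ᵇ_; z≤n; s≤s; _!; NonZero)
open import Data.Nat.Combinatorics using (_C_; nCk+nC[k+1]≡[n+1]C[k+1]; nC1≡n)
open import Data.Nat.Properties hiding (≡ᵇ⇒≡; ≡⇒≡ᵇ)
open import Data.Nat.Tactic.RingSolver using (solve-∀)
open import Data.Product using (Σ; _×_; _,_)
open import Data.Vec using ([]; _∷_; lookup)
open import Data.Vec.Properties using (lookup-replicate)
open import Function using (_∘_; Equivalence)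
open import Relation.Binary.PropositionalEquality
open import Relation.Nullary using (¬_; yes; no; contradiction)
open import Relation.Nullary.Decidable using (decidable-stable)

import Data.Integer as ℤ
import Data.Integer.Properties as ℤ
open import Data.Rational using (ℚ; 0ℚ; 1ℚ; _/_; mkℚ; ↧ₙ_; nonNegative; *≤*; *<*)
  renaming (_≤_ to _≤ℚ_; _<_ to _<ℚ_; _+_ to _+ℚ_; _*_ to _*ℚ_; _-_ to _-ℚ_; -_ to -ℚ_)
import Data.Rational.Properties as ℚ
import Data.Rational.Unnormalised as ℚᵘ
import Data.Rational.Unnormalised.Properties as ℚᵘ
open import Data.Rational.Solver using (module +-*-Solver)
open +-*-Solver using (solve; _:+_; _:*_; _:-_; _:=_; con)
open import Data.Nat.Coprimality using (1-coprimeTo) renaming (sym to coprime-sym)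

open import Defs

open Sum +-0-commutativeMonoid using (sum; sum-syntax; ∑-distrib-+; sum-cong-≗)
open import Algebra.Properties.CommutativeSemigroup +-commutativeSemigroup using (interchange)

-- Counting subsets

𝟙 : Bool → ℕ
𝟙 true  = 1
𝟙 false = 0

sumSubsets : ∀ {n} → (Subset n → ℕ) → ℕ
sumSubsets {zero}  f = f []
sumSubsets {suc n} f = sumSubsets (f ∘ (true ∷_)) + sumSubsets (f ∘ (false ∷_))

sumSubsets-cong : ∀ {n} {f g : Subset n → ℕ} → (∀ e → f e ≡ g e) → sumSubsets f ≡ sumSubsets g
sumSubsets-cong {zero}  f≗g = f≗g []
sumSubsets-cong {suc n} f≗g =
  cong₂ _+_ (sumSubsets-cong (f≗g ∘ (true ∷_))) (sumSubsets-cong (f≗g ∘ (false ∷_)))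

sumSubsets-mono-≤ : ∀ {n} {f g : Subset n → ℕ} → (∀ e → f e ≤ g e) → sumSubsets f ≤ sumSubsets g
sumSubsets-mono-≤ {zero}  f≤g = f≤g []
sumSubsets-mono-≤ {suc n} f≤g =
  +-mono-≤ (sumSubsets-mono-≤ (f≤g ∘ (true ∷_))) (sumSubsets-mono-≤ (f≤g ∘ (false ∷_)))

sumSubsets-distrib-+ : ∀ {n} (f g : Subset n → ℕ) →
                       sumSubsets (λ e → f e + g e) ≡ sumSubsets f + sumSubsets g
sumSubsets-distrib-+ {zero}  f g = refl
sumSubsets-distrib-+ {suc n} f g =
  trans (cong₂ _+_ (sumSubsets-distrib-+ (f ∘ (true ∷_)) (g ∘ (true ∷_)))
                   (sumSubsets-distrib-+ (f ∘ (false ∷_)) (g ∘ (false ∷_))))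
        (interchange (sumSubsets (f ∘ (true ∷_))) (sumSubsets (g ∘ (true ∷_)))
                     (sumSubsets (f ∘ (false ∷_))) (sumSubsets (g ∘ (false ∷_))))

sumSubsets-*ˡ : ∀ {n} c (f : Subset n → ℕ) → sumSubsets (λ e → c * f e) ≡ c * sumSubsets f
sumSubsets-*ˡ {zero}  c f = refl
sumSubsets-*ˡ {suc n} c f =
  trans (cong₂ _+_ (sumSubsets-*ˡ c (f ∘ (true ∷_))) (sumSubsets-*ˡ c (f ∘ (false ∷_))))
        (sym (*-distribˡ-+ c _ _))

length-filter-++ : ∀ {A : Set} (P : A → Bool) (xs ys : List A) →
                   length (filter (T? ∘ P) (xs ++ ys)) ≡ length (filter (T? ∘ P) xs) + length (filter (T? ∘ P) ys)
length-filter-++ P xs ys = trans (cong length (filter-++ (T? ∘ P) xs ys)) (length-++ (filter (T? ∘ P) xs))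

length-filter-map : ∀ {A B : Set} (P : B → Bool) (f : A → B) (xs : List A) →
                    length (filter (T? ∘ P) (List.map f xs)) ≡ length (filter (T? ∘ P ∘ f) xs)
length-filter-map P f []       = refl
length-filter-map P f (x ∷ xs) with P (f x)
... | true  = cong suc (length-filter-map P f xs)
... | false = length-filter-map P f xs

count-suc : ∀ {n} (P : Subset (suc n) → Bool) → count P ≡ count (P ∘ (true ∷_)) + count (P ∘ (false ∷_))
count-suc {n} P =
  trans (length-filter-++ P (List.map (true ∷_) (allSubsets n)) (List.map (false ∷_) (allSubsets n)))
        (cong₂ _+_ (length-filter-map P (true ∷_) (allSubsets n)) (length-filter-map P (false ∷_) (allSubsets n)))

count≡sumSubsets : ∀ {n} (P : Subset n → Bool) → count P ≡ sumSubsets (𝟙 ∘ P)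
count≡sumSubsets {zero}  P with P []
... | true  = refl
... | false = refl
count≡sumSubsets {suc n} P =
  trans (count-suc P) (cong₂ _+_ (count≡sumSubsets (P ∘ (true ∷_))) (count≡sumSubsets (P ∘ (false ∷_))))

count-cong : ∀ {n} {P Q : Subset n → Bool} → (∀ e → P e ≡ Q e) → count P ≡ count Q
count-cong {P = P} {Q} P≗Q = begin
  count P               ≡⟨ count≡sumSubsets P ⟩
  sumSubsets (𝟙 ∘ P)    ≡⟨ sumSubsets-cong (cong 𝟙 ∘ P≗Q) ⟩
  sumSubsets (𝟙 ∘ Q)    ≡⟨ count≡sumSubsets Q ⟨
  count Q               ∎
  where open ≡-Reasoning

count-mono : ∀ {n} {P Q : Subset n → Bool} → (∀ e → P e ≡ true → Q e ≡ true) → count P ≤ count Q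
count-mono {P = P} {Q} P⇒Q = begin
  count P               ≡⟨ count≡sumSubsets P ⟩
  sumSubsets (𝟙 ∘ P)    ≤⟨ sumSubsets-mono-≤ (λ e → 𝟙-mono (P⇒Q e)) ⟩
  sumSubsets (𝟙 ∘ Q)    ≡⟨ count≡sumSubsets Q ⟨
  count Q               ∎
  where
  open ≤-Reasoning
  𝟙-mono : ∀ {a b} → (a ≡ true → b ≡ true) → 𝟙 a ≤ 𝟙 b
  𝟙-mono {false} _   = z≤n
  𝟙-mono {true}  a⇒b rewrite a⇒b refl = ≤-refl

count-split : ∀ {n} (P Q : Subset n → Bool) →
              count P ≡ count (λ e → P e ∧ Q e) + count (λ e → P e ∧ not (Q e))
count-split {n} P Q = begin
  count P
    ≡⟨ count≡sumSubsets P ⟩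
  sumSubsets (𝟙 ∘ P)
    ≡⟨ sumSubsets-cong (λ e → 𝟙-split (P e) (Q e)) ⟩
  sumSubsets (λ e → 𝟙 (P e ∧ Q e) + 𝟙 (P e ∧ not (Q e)))
    ≡⟨ sumSubsets-distrib-+ {n} _ _ ⟩
  sumSubsets (λ e → 𝟙 (P e ∧ Q e)) + sumSubsets (λ e → 𝟙 (P e ∧ not (Q e)))
    ≡⟨ cong₂ _+_ (count≡sumSubsets {n} _) (count≡sumSubsets {n} _) ⟨
  count (λ e → P e ∧ Q e) + count (λ e → P e ∧ not (Q e)) ∎
  where
  open ≡-Reasoning
  𝟙-split : ∀ a b → 𝟙 a ≡ 𝟙 (a ∧ b) + 𝟙 (a ∧ not b)
  𝟙-split false _     = refl
  𝟙-split true  false = refl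
  𝟙-split true  true  = refl

count-none : ∀ {n} {P : Subset n → Bool} → (∀ e → P e ≡ false) → count P ≡ 0
count-none {n} {P} P≗false = begin
  count P                    ≡⟨ count≡sumSubsets P ⟩
  sumSubsets (𝟙 ∘ P)         ≡⟨ sumSubsets-cong {n} (cong 𝟙 ∘ P≗false) ⟩
  sumSubsets {n} (λ _ → 0)   ≡⟨ sumSubsets-*ˡ {n} 0 (λ _ → 0) ⟩
  0                          ∎
  where open ≡-Reasoning

∣∷∣ : ∀ {n} b (s : Subset n) → ∣ b ∷ s ∣ ≡ 𝟙 b + ∣ s ∣
∣∷∣ true  s = refl
∣∷∣ false s = refl

∑-mono-≤ : ∀ {n} {f g : Fin n → ℕ} → (∀ i → f i ≤ g i) → sum f ≤ sum g
∑-mono-≤ {zero}  f≤g = z≤n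
∑-mono-≤ {suc n} f≤g = +-mono-≤ (f≤g zero) (∑-mono-≤ (f≤g ∘ suc))

∑𝟙*≡∣∣* : ∀ {n} (X : Subset n) c → ∑[ v < n ] (𝟙 (lookup X v) * c) ≡ ∣ X ∣ * c
∑𝟙*≡∣∣* []          c = refl
∑𝟙*≡∣∣* (true  ∷ X) c = cong₂ _+_ (+-identityʳ c) (∑𝟙*≡∣∣* X c)
∑𝟙*≡∣∣* (false ∷ X) c = ∑𝟙*≡∣∣* X c

incidences : ∀ {n} → Subset n → (Subset n → Bool) → ℕ
incidences {n} U Q = ∑[ v < n ] (𝟙 (lookup U v) * count (λ e → Q e ∧ lookup e v))

incidences≡sumSubsets : ∀ {n} (U : Subset n) (Q : Subset n → Bool) →
                        incidences U Q ≡ sumSubsets (λ e → 𝟙 (Q e) * ∣ e ∩ U ∣)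
incidences≡sumSubsets {zero}  [] Q = sym (*-zeroʳ (𝟙 (Q [])))
incidences≡sumSubsets {suc n} (u ∷ U) Q = begin
  𝟙 u * count (λ e → Q e ∧ lookup e zero) + ∑[ v < n ] (𝟙 (lookup U v) * count (λ e → Q e ∧ lookup e (suc v)))
    ≡⟨ cong₂ _+_ (cong (𝟙 u *_) count-∋zero) (sum-cong-≗ count-∋suc) ⟩
  𝟙 u * count Q₁ + ∑[ v < n ] (𝟙 (lookup U v) * count (λ e → Q₁ e ∧ lookup e v) + 𝟙 (lookup U v) * count (λ e → Q₀ e ∧ lookup e v))
    ≡⟨ cong (𝟙 u * count Q₁ +_) (∑-distrib-+ (summand Q₁) (summand Q₀)) ⟩
  𝟙 u * count Q₁ + (incidences U Q₁ + incidences U Q₀)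
    ≡⟨ +-assoc (𝟙 u * count Q₁) _ _ ⟨
  (𝟙 u * count Q₁ + incidences U Q₁) + incidences U Q₀
    ≡⟨ cong₂ _+_ (cong₂ _+_ (cong (𝟙 u *_) (count≡sumSubsets Q₁)) (incidences≡sumSubsets U Q₁))
                 (incidences≡sumSubsets U Q₀) ⟩
  (𝟙 u * sumSubsets (𝟙 ∘ Q₁) + sumSubsets (λ e → 𝟙 (Q₁ e) * ∣ e ∩ U ∣)) + sumSubsets (λ e → 𝟙 (Q₀ e) * ∣ e ∩ U ∣)
    ≡⟨ cong (_+ sumSubsets (λ e → 𝟙 (Q₀ e) * ∣ e ∩ U ∣)) sumSubsets-Q₁ ⟨
  sumSubsets (λ e → 𝟙 (Q₁ e) * ∣ u ∷ (e ∩ U) ∣) + sumSubsets (λ e → 𝟙 (Q₀ e) * ∣ e ∩ U ∣) ∎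
  where
  open ≡-Reasoning
  Q₁ Q₀ : Subset n → Bool
  Q₁ = Q ∘ (true ∷_)
  Q₀ = Q ∘ (false ∷_)
  summand : (Subset n → Bool) → Fin n → ℕ
  summand P v = 𝟙 (lookup U v) * count (λ e → P e ∧ lookup e v)
  count-∋zero : count (λ e → Q e ∧ lookup e zero) ≡ count Q₁
  count-∋zero = begin
    count (λ e → Q e ∧ lookup e zero)
      ≡⟨ count-suc (λ e → Q e ∧ lookup e zero) ⟩
    count (λ e → Q₁ e ∧ true) + count (λ e → Q₀ e ∧ false)
      ≡⟨ cong₂ _+_ (count-cong (∧-identityʳ ∘ Q₁)) (count-none (∧-zeroʳ ∘ Q₀)) ⟩
    count Q₁ + 0
      ≡⟨ +-identityʳ (count Q₁) ⟩
    count Q₁ ∎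
  count-∋suc : ∀ v → 𝟙 (lookup U v) * count (λ e → Q e ∧ lookup e (suc v))
                   ≡ 𝟙 (lookup U v) * count (λ e → Q₁ e ∧ lookup e v) + 𝟙 (lookup U v) * count (λ e → Q₀ e ∧ lookup e v)
  count-∋suc v = trans (cong (𝟙 (lookup U v) *_) (count-suc {n} _)) (*-distribˡ-+ (𝟙 (lookup U v)) _ _)
  sumSubsets-Q₁ : sumSubsets (λ e → 𝟙 (Q₁ e) * ∣ u ∷ (e ∩ U) ∣)
                ≡ 𝟙 u * sumSubsets (𝟙 ∘ Q₁) + sumSubsets (λ e → 𝟙 (Q₁ e) * ∣ e ∩ U ∣)
  sumSubsets-Q₁ = begin
    sumSubsets (λ e → 𝟙 (Q₁ e) * ∣ u ∷ (e ∩ U) ∣)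
      ≡⟨ sumSubsets-cong (λ e → cong (𝟙 (Q₁ e) *_) (∣∷∣ u (e ∩ U))) ⟩
    sumSubsets (λ e → 𝟙 (Q₁ e) * (𝟙 u + ∣ e ∩ U ∣))
      ≡⟨ sumSubsets-cong (λ e → *-distribˡ-+ (𝟙 (Q₁ e)) (𝟙 u) _) ⟩
    sumSubsets (λ e → 𝟙 (Q₁ e) * 𝟙 u + 𝟙 (Q₁ e) * ∣ e ∩ U ∣)
      ≡⟨ sumSubsets-distrib-+ {n} _ _ ⟩
    sumSubsets (λ e → 𝟙 (Q₁ e) * 𝟙 u) + sumSubsets (λ e → 𝟙 (Q₁ e) * ∣ e ∩ U ∣)
      ≡⟨ cong (_+ sumSubsets (λ e → 𝟙 (Q₁ e) * ∣ e ∩ U ∣)) (trans (sumSubsets-cong (λ e → *-comm (𝟙 (Q₁ e)) (𝟙 u))) (sumSubsets-*ˡ (𝟙 u) (𝟙 ∘ Q₁))) ⟩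
    𝟙 u * sumSubsets (𝟙 ∘ Q₁) + sumSubsets (λ e → 𝟙 (Q₁ e) * ∣ e ∩ U ∣) ∎

count≤incidences : ∀ {n} (U : Subset n) (Q : Subset n → Bool) →
                   (∀ e → Q e ≡ true → 1 ≤ ∣ e ∩ U ∣) → count Q ≤ incidences U Q
count≤incidences U Q meetsU = begin
  count Q                                      ≡⟨ count≡sumSubsets Q ⟩
  sumSubsets (𝟙 ∘ Q)                           ≤⟨ sumSubsets-mono-≤ pointwise ⟩
  sumSubsets (λ e → 𝟙 (Q e) * ∣ e ∩ U ∣)       ≡⟨ incidences≡sumSubsets U Q ⟨
  incidences U Q                               ∎
  where
  open ≤-Reasoning
  pointwise : ∀ e → 𝟙 (Q e) ≤ 𝟙 (Q e) * ∣ e ∩ U ∣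
  pointwise e with Q e | meetsU e
  ... | true  | 1≤∣e∩U∣ = ≤-trans (1≤∣e∩U∣ refl) (≤-reflexive (sym (*-identityˡ _)))
  ... | false | _       = z≤n

incidences≤*count : ∀ {n} (U : Subset n) (Q : Subset n → Bool) k →
                    (∀ e → Q e ≡ true → ∣ e ∩ U ∣ ≤ k) → incidences U Q ≤ k * count Q
incidences≤*count U Q k bounded = begin
  incidences U Q                               ≡⟨ incidences≡sumSubsets U Q ⟩
  sumSubsets (λ e → 𝟙 (Q e) * ∣ e ∩ U ∣)       ≤⟨ sumSubsets-mono-≤ pointwise ⟩
  sumSubsets (λ e → k * 𝟙 (Q e))               ≡⟨ sumSubsets-*ˡ k (𝟙 ∘ Q) ⟩
  k * sumSubsets (𝟙 ∘ Q)                       ≡⟨ cong (k *_) (count≡sumSubsets Q) ⟨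
  k * count Q                                  ∎
  where
  open ≤-Reasoning
  pointwise : ∀ e → 𝟙 (Q e) * ∣ e ∩ U ∣ ≤ k * 𝟙 (Q e)
  pointwise e with Q e | bounded e
  ... | true  | ∣e∩U∣≤k = ≤-trans (≤-reflexive (*-identityˡ _)) (≤-trans (∣e∩U∣≤k refl) (≤-reflexive (sym (*-identityʳ k))))
  ... | false | _       = z≤n

count-⊆-size≡C : ∀ {n} (X : Subset n) j → count (λ e → (∣ e ∣ ≡ᵇ j) ∧ (e ⊆ᵇ X)) ≡ ∣ X ∣ C j
count-⊆-size≡C []      zero    = refl
count-⊆-size≡C []      (suc j) = refl
count-⊆-size≡C {suc n} (true ∷ X) zero =
  trans (count-suc (λ e → (∣ e ∣ ≡ᵇ 0) ∧ (e ⊆ᵇ (true ∷ X))))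
        (cong₂ _+_ (count-none {n} (λ _ → refl)) (count-⊆-size≡C X zero))
count-⊆-size≡C (true ∷ X) (suc j) =
  trans (count-suc (λ e → (∣ e ∣ ≡ᵇ suc j) ∧ (e ⊆ᵇ (true ∷ X))))
        (trans (cong₂ _+_ (count-⊆-size≡C X j) (count-⊆-size≡C X (suc j)))
               (nCk+nC[k+1]≡[n+1]C[k+1] ∣ X ∣ j))
count-⊆-size≡C {suc n} (false ∷ X) j =
  trans (count-suc (λ e → (∣ e ∣ ≡ᵇ j) ∧ (e ⊆ᵇ (false ∷ X))))
        (cong₂ _+_ (count-none {n} (λ e → ∧-zeroʳ (∣ true ∷ e ∣ ≡ᵇ j))) (count-⊆-size≡C X j))

count-∋-⊆-size≡C : ∀ {n} (X : Subset n) v → lookup X v ≡ true → ∀ j →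
                   count (λ e → ((∣ e ∣ ≡ᵇ suc j) ∧ lookup e v) ∧ (e ⊆ᵇ X)) ≡ (∣ X ∣ ∸ 1) C j
count-∋-⊆-size≡C (true ∷ X) zero v∈X j =
  trans (count-suc (λ e → ((∣ e ∣ ≡ᵇ suc j) ∧ lookup e zero) ∧ (e ⊆ᵇ (true ∷ X))))
        (trans (cong₂ _+_ (count-cong (λ e → cong (_∧ (e ⊆ᵇ X)) (∧-identityʳ (∣ e ∣ ≡ᵇ j))))
                          (count-none (λ e → cong (_∧ (e ⊆ᵇ X)) (∧-zeroʳ (∣ e ∣ ≡ᵇ suc j)))))
               (trans (+-identityʳ _) (count-⊆-size≡C X j)))
count-∋-⊆-size≡C (true ∷ X) (suc v) v∈X zero =
  trans (count-suc (λ e → ((∣ e ∣ ≡ᵇ 1) ∧ lookup e (suc v)) ∧ (e ⊆ᵇ (true ∷ X))))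
        (cong₂ _+_ (count-none (λ e → cong (_∧ (e ⊆ᵇ X)) (empty-∌ e v))) (count-∋-⊆-size≡C X v v∈X zero))
  where
  empty-∌ : ∀ {n} (e : Subset n) v → (∣ e ∣ ≡ᵇ 0) ∧ lookup e v ≡ false
  empty-∌ (true  ∷ e) zero    = refl
  empty-∌ (true  ∷ e) (suc v) = refl
  empty-∌ (false ∷ e) zero    = ∧-zeroʳ (∣ e ∣ ≡ᵇ 0)
  empty-∌ (false ∷ e) (suc v) = empty-∌ e v
count-∋-⊆-size≡C (true ∷ X) (suc v) v∈X (suc j) =
  trans (count-suc (λ e → ((∣ e ∣ ≡ᵇ suc (suc j)) ∧ lookup e (suc v)) ∧ (e ⊆ᵇ (true ∷ X))))
        (trans (cong₂ _+_ (count-∋-⊆-size≡C X v v∈X j) (count-∋-⊆-size≡C X v v∈X (suc j)))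
               (trans (nCk+nC[k+1]≡[n+1]C[k+1] (∣ X ∣ ∸ 1) j)
                      (cong (_C suc j) (sym (+-∸-assoc 1 (∈⇒∣∣≥1 X v v∈X))))))
  where
  ∈⇒∣∣≥1 : ∀ {n} (X : Subset n) v → lookup X v ≡ true → 1 ≤ ∣ X ∣
  ∈⇒∣∣≥1 (true  ∷ X) v       _   = s≤s z≤n
  ∈⇒∣∣≥1 (false ∷ X) (suc v) v∈X = ∈⇒∣∣≥1 X v v∈X
count-∋-⊆-size≡C {suc n} (false ∷ X) (suc v) v∈X j =
  trans (count-suc (λ e → ((∣ e ∣ ≡ᵇ suc j) ∧ lookup e (suc v)) ∧ (e ⊆ᵇ (false ∷ X))))
        (cong₂ _+_ (count-none {n} (λ e → ∧-zeroʳ (((∣ e ∣ ≡ᵇ j) ∧ lookup e v)))) (count-∋-⊆-size≡C X v v∈X j))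

∣⊤∣≡n : ∀ n → ∣ ⊤ {n} ∣ ≡ n
∣⊤∣≡n zero    = refl
∣⊤∣≡n (suc n) = cong suc (∣⊤∣≡n n)

count-∋-size≡C : ∀ {n} (v : Fin n) j → count (λ e → (∣ e ∣ ≡ᵇ suc j) ∧ lookup e v) ≡ (n ∸ 1) C j
count-∋-size≡C {n} v j = begin
  count (λ e → (∣ e ∣ ≡ᵇ suc j) ∧ lookup e v)
    ≡⟨ count-cong (λ e → trans (sym (∧-identityʳ _)) (cong (((∣ e ∣ ≡ᵇ suc j) ∧ lookup e v) ∧_) (sym (⊆ᵇ⊤ e)))) ⟩
  count (λ e → ((∣ e ∣ ≡ᵇ suc j) ∧ lookup e v) ∧ (e ⊆ᵇ ⊤))
    ≡⟨ count-∋-⊆-size≡C ⊤ v (lookup-replicate v true) j ⟩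
  (∣ ⊤ {n} ∣ ∸ 1) C j
    ≡⟨ cong (λ x → (x ∸ 1) C j) (∣⊤∣≡n n) ⟩
  (n ∸ 1) C j ∎
  where
  open ≡-Reasoning
  ⊆ᵇ⊤ : ∀ {n} (e : Subset n) → e ⊆ᵇ ⊤ ≡ true
  ⊆ᵇ⊤ []          = refl
  ⊆ᵇ⊤ (true  ∷ e) = ⊆ᵇ⊤ e
  ⊆ᵇ⊤ (false ∷ e) = ⊆ᵇ⊤ e

∣∩∣+∣∩∁∣≡∣∣ : ∀ {n} (e X : Subset n) → ∣ e ∩ X ∣ + ∣ e ∩ ∁ X ∣ ≡ ∣ e ∣
∣∩∣+∣∩∁∣≡∣∣ []          []          = refl
∣∩∣+∣∩∁∣≡∣∣ (true  ∷ e) (true  ∷ X) = cong suc (∣∩∣+∣∩∁∣≡∣∣ e X)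
∣∩∣+∣∩∁∣≡∣∣ (true  ∷ e) (false ∷ X) = trans (+-suc _ _) (cong suc (∣∩∣+∣∩∁∣≡∣∣ e X))
∣∩∣+∣∩∁∣≡∣∣ (false ∷ e) (_     ∷ X) = ∣∩∣+∣∩∁∣≡∣∣ e X

∣∣+∣∁∣≡n : ∀ {n} (X : Subset n) → ∣ X ∣ + ∣ ∁ X ∣ ≡ n
∣∣+∣∁∣≡n []          = refl
∣∣+∣∁∣≡n (true  ∷ X) = cong suc (∣∣+∣∁∣≡n X)
∣∣+∣∁∣≡n (false ∷ X) = trans (+-suc _ _) (cong suc (∣∣+∣∁∣≡n X))

∣∩∣≤∣∣ : ∀ {n} (e X : Subset n) → ∣ e ∩ X ∣ ≤ ∣ e ∣
∣∩∣≤∣∣ []          []          = z≤n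
∣∩∣≤∣∣ (true  ∷ e) (true  ∷ X) = s≤s (∣∩∣≤∣∣ e X)
∣∩∣≤∣∣ (true  ∷ e) (false ∷ X) = m≤n⇒m≤1+n (∣∩∣≤∣∣ e X)
∣∩∣≤∣∣ (false ∷ e) (_     ∷ X) = ∣∩∣≤∣∣ e X

meets : ∀ {n} → Subset n → Subset n → Bool
meets X e = 1 ≤ᵇ ∣ e ∩ X ∣

meets⇒1≤∣∩∣ : ∀ {n} (X e : Subset n) → meets X e ≡ true → 1 ≤ ∣ e ∩ X ∣
meets⇒1≤∣∩∣ X e p with ∣ e ∩ X ∣
... | suc _ = s≤s z≤n

not-meets≡⊆ᵇ∁ : ∀ {n} (X e : Subset n) → not (meets X e) ≡ e ⊆ᵇ ∁ X
not-meets≡⊆ᵇ∁ []          []          = refl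
not-meets≡⊆ᵇ∁ (true  ∷ X) (true  ∷ e) = refl
not-meets≡⊆ᵇ∁ (false ∷ X) (true  ∷ e) = not-meets≡⊆ᵇ∁ X e
not-meets≡⊆ᵇ∁ (_     ∷ X) (false ∷ e) = not-meets≡⊆ᵇ∁ X e

⊆ᵇ∧⊈ᵇ⇒meets-∖ : ∀ {n} (e S X : Subset n) → e ⊆ᵇ X ≡ true → e ⊆ᵇ S ≡ false → meets (∁ S ∩ X) e ≡ true
⊆ᵇ∧⊈ᵇ⇒meets-∖ []          []          []          _    ()
⊆ᵇ∧⊈ᵇ⇒meets-∖ (true  ∷ e) (_     ∷ S) (false ∷ X) ()   _
⊆ᵇ∧⊈ᵇ⇒meets-∖ (true  ∷ e) (false ∷ S) (true  ∷ X) _    _    = refl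
⊆ᵇ∧⊈ᵇ⇒meets-∖ (true  ∷ e) (true  ∷ S) (true  ∷ X) e⊆X  e⊈S = ⊆ᵇ∧⊈ᵇ⇒meets-∖ e S X e⊆X e⊈S
⊆ᵇ∧⊈ᵇ⇒meets-∖ (false ∷ e) (_     ∷ S) (_     ∷ X) e⊆X  e⊈S = ⊆ᵇ∧⊈ᵇ⇒meets-∖ e S X e⊆X e⊈S

covering-subset : ∀ {n} (T : Subset n) j → j ≤ n → Σ (Subset n) λ W → ∣ W ∣ ≡ j × ∣ T ∩ ∁ W ∣ ≤ ∣ T ∣ ∸ j
covering-subset {n} T zero _ = ∅ , ∣∅∣≡0 n , ∣∩∣≤∣∣ T (∁ ∅)
  where
  ∣∅∣≡0 : ∀ n → ∣ ∅ {n} ∣ ≡ 0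
  ∣∅∣≡0 zero    = refl
  ∣∅∣≡0 (suc n) = ∣∅∣≡0 n
covering-subset (true ∷ T) (suc j) (s≤s j≤n) with covering-subset T j j≤n
... | W , ∣W∣≡j , ∣T∖W∣≤ = true ∷ W , cong suc ∣W∣≡j , ∣T∖W∣≤
covering-subset {suc n} (false ∷ T) (suc j) (s≤s j≤n) with suc j ≤? n
... | yes 1+j≤n = let W , ∣W∣≡1+j , ∣T∖W∣≤ = covering-subset T (suc j) 1+j≤n in false ∷ W , ∣W∣≡1+j , ∣T∖W∣≤
... | no  1+j≰n = ⊤ , cong suc (trans (∣⊤∣≡n n) (≤-antisym (≮⇒≥ 1+j≰n) j≤n)) , ≤-trans (≤-reflexive (∣∩∁⊤∣≡0 T)) z≤n
  where
  ∣∩∁⊤∣≡0 : ∀ {n} (T : Subset n) → ∣ T ∩ ∁ ⊤ ∣ ≡ 0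
  ∣∩∁⊤∣≡0 []          = refl
  ∣∩∁⊤∣≡0 (true  ∷ T) = ∣∩∁⊤∣≡0 T
  ∣∩∁⊤∣≡0 (false ∷ T) = ∣∩∁⊤∣≡0 T

-- Binomial inequalities

C-absorption : ∀ a b → suc b * (suc a C suc b) ≡ suc a * (a C b)
C-absorption zero    zero    = refl
C-absorption zero    (suc b) = *-zeroʳ (suc (suc b))
C-absorption (suc a) zero    = trans (+-identityʳ _) (trans (nC1≡n (suc (suc a))) (sym (*-identityʳ (suc (suc a)))))
C-absorption (suc a) (suc b) = begin
  suc (suc b) * (suc (suc a) C suc (suc b))
    ≡⟨ cong (suc (suc b) *_) (nCk+nC[k+1]≡[n+1]C[k+1] (suc a) (suc b)) ⟨
  suc (suc b) * (X + Y)
    ≡⟨ distribute (suc b) X Y ⟩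
  suc b * X + X + suc (suc b) * Y
    ≡⟨ cong₂ (λ u w → u + X + w) (C-absorption a b) (C-absorption a (suc b)) ⟩
  suc a * (a C b) + X + suc a * (a C suc b)
    ≡⟨ collect (suc a) (a C b) (a C suc b) X ⟩
  suc a * (a C b + a C suc b) + X
    ≡⟨ cong (λ z → suc a * z + X) (nCk+nC[k+1]≡[n+1]C[k+1] a b) ⟩
  suc a * X + X
    ≡⟨ +-comm (suc a * X) X ⟩
  suc (suc a) * X ∎
  where
  open ≡-Reasoning
  X = suc a C suc b
  Y = suc a C suc (suc b)
  distribute : ∀ c X Y → suc c * (X + Y) ≡ c * X + X + suc c * Y
  distribute = solve-∀
  collect : ∀ s p q X → s * p + X + s * q ≡ s * (p + q) + X
  collect = solve-∀

C*!≤^ : ∀ a b → (a C b) * b ! ≤ a ^ b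
C*!≤^ a       zero    = ≤-refl
C*!≤^ zero    (suc b) = z≤n
C*!≤^ (suc a) (suc b) = begin
  (suc a C suc b) * (suc b * b !)   ≡⟨ regroup (suc a C suc b) (suc b) (b !) ⟩
  suc b * (suc a C suc b) * b !     ≡⟨ cong (_* b !) (C-absorption a b) ⟩
  suc a * (a C b) * b !             ≡⟨ *-assoc (suc a) (a C b) (b !) ⟩
  suc a * ((a C b) * b !)           ≤⟨ *-monoʳ-≤ (suc a) (C*!≤^ a b) ⟩
  suc a * a ^ b                     ≤⟨ *-monoʳ-≤ (suc a) (^-monoˡ-≤ b (n≤1+n a)) ⟩
  suc a * suc a ^ b                 ∎
  where
  open ≤-Reasoning
  regroup : ∀ x y z → x * (y * z) ≡ y * x * z
  regroup = solve-∀

2k≤3[k-1]! : ∀ t → 2 * (3 + t) ≤ 3 * (2 + t) !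
2k≤3[k-1]! zero    = ≤-refl
2k≤3[k-1]! (suc t) = begin
  2 * (3 + suc t)                 ≡⟨ trans (*-suc 2 (3 + t)) (+-comm 2 _) ⟩
  2 * (3 + t) + 2                 ≤⟨ +-mono-≤ (2k≤3[k-1]! t) (*-monoʳ-≤ 2 (1≤n! (2 + t))) ⟩
  3 * F + 2 * F                   ≤⟨ +-monoʳ-≤ (3 * F) (*-monoˡ-≤ F (m≤m+n 2 (4 + 3 * t))) ⟩
  3 * F + (2 + (4 + 3 * t)) * F   ≡⟨ regroup t F ⟩
  3 * ((3 + t) * F)               ∎
  where
  open ≤-Reasoning
  F = (2 + t) !
  regroup : ∀ t F → 3 * F + (2 + (4 + 3 * t)) * F ≡ 3 * ((3 + t) * F)
  regroup = solve-∀

2k*C≤3*n^[k-1] : ∀ t n → 2 * (3 + t) * ((n ∸ 1) C (2 + t)) ≤ 3 * n ^ (2 + t)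
2k*C≤3*n^[k-1] t n = begin
  2 * (3 + t) * C′                  ≤⟨ *-monoˡ-≤ C′ (2k≤3[k-1]! t) ⟩
  3 * (2 + t) ! * C′                ≡⟨ regroup 3 ((2 + t) !) C′ ⟩
  3 * (C′ * (2 + t) !)              ≤⟨ *-monoʳ-≤ 3 (C*!≤^ (n ∸ 1) (2 + t)) ⟩
  3 * (n ∸ 1) ^ (2 + t)             ≤⟨ *-monoʳ-≤ 3 (^-monoˡ-≤ (2 + t) (m∸n≤m n 1)) ⟩
  3 * n ^ (2 + t)                   ∎
  where
  open ≤-Reasoning
  C′ = (n ∸ 1) C (2 + t)
  regroup : ∀ a b c → a * b * c ≡ a * (c * b)
  regroup = solve-∀

-- Rational arithmetic

toℚ≡mkℚ : ∀ a → toℚ a ≡ mkℚ (ℤ.+ a) 0 (coprime-sym (1-coprimeTo a))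
toℚ≡mkℚ a = ℚ.normalize-coprime (coprime-sym (1-coprimeTo a))

toℚ-+ : ∀ a b → toℚ (a + b) ≡ toℚ a +ℚ toℚ b
toℚ-+ a b rewrite toℚ≡mkℚ a | toℚ≡mkℚ b =
  cong (_/ 1) (sym (cong₂ ℤ._+_ (ℤ.*-identityʳ (ℤ.+ a)) (ℤ.*-identityʳ (ℤ.+ b))))

toℚ-* : ∀ a b → toℚ (a * b) ≡ toℚ a *ℚ toℚ b
toℚ-* a b rewrite toℚ≡mkℚ a | toℚ≡mkℚ b = cong (_/ 1) (ℤ.pos-* a b)

toℚ-mono-≤ : ∀ {a b} → a ≤ b → toℚ a ≤ℚ toℚ b
toℚ-mono-≤ {a} {b} a≤b rewrite toℚ≡mkℚ a | toℚ≡mkℚ b =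
  *≤* (subst₂ ℤ._≤_ (sym (ℤ.*-identityʳ (ℤ.+ a))) (sym (ℤ.*-identityʳ (ℤ.+ b))) (ℤ.+≤+ a≤b))

0≤/ : ∀ a b .{{_ : NonZero b}} → 0ℚ ≤ℚ (ℤ.+ a) / b
0≤/ a b = ℚ.nonNegative⁻¹ _ {{ℚ.normalize-nonNeg a b}}

toℚ-nonNeg : ∀ a → 0ℚ ≤ℚ toℚ a
toℚ-nonNeg a = 0≤/ a 1

nonNeg-* : ∀ {p q} → 0ℚ ≤ℚ p → 0ℚ ≤ℚ q → 0ℚ ≤ℚ p *ℚ q
nonNeg-* {p} {q} 0≤p 0≤q = ℚ.≤-trans (ℚ.≤-reflexive (sym (ℚ.*-zeroʳ p))) (ℚ.*-monoˡ-≤-nonNeg p {{nonNegative 0≤p}} 0≤q)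

toℚ-∑-≤ : ∀ {n} (r : ℚ) (f g : Fin n → ℕ) → (∀ v → toℚ (f v) ≤ℚ r +ℚ toℚ (g v)) →
          toℚ (sum f) ≤ℚ toℚ n *ℚ r +ℚ toℚ (sum g)
toℚ-∑-≤ {zero}  r f g _  = ℚ.≤-reflexive (solve 1 (λ r → con 0ℚ := con 0ℚ :* r :+ con 0ℚ) refl r)
toℚ-∑-≤ {suc n} r f g f≤ = begin
  toℚ (f zero + sum (f ∘ suc))
    ≡⟨ toℚ-+ (f zero) _ ⟩
  toℚ (f zero) +ℚ toℚ (sum (f ∘ suc))
    ≤⟨ ℚ.+-mono-≤ (f≤ zero) (toℚ-∑-≤ r (f ∘ suc) (g ∘ suc) (f≤ ∘ suc)) ⟩
  (r +ℚ toℚ (g zero)) +ℚ (toℚ n *ℚ r +ℚ toℚ (sum (g ∘ suc)))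
    ≡⟨ solve 4 (λ r g N G → (r :+ g) :+ (N :* r :+ G) := (con 1ℚ :+ N) :* r :+ (g :+ G)) refl
               r (toℚ (g zero)) (toℚ n) (toℚ (sum (g ∘ suc))) ⟩
  (1ℚ +ℚ toℚ n) *ℚ r +ℚ (toℚ (g zero) +ℚ toℚ (sum (g ∘ suc)))
    ≡⟨ cong₂ (λ a b → a *ℚ r +ℚ b) (toℚ-+ 1 n) (toℚ-+ (g zero) _) ⟨
  toℚ (suc n) *ℚ r +ℚ toℚ (sum g) ∎
  where open ℚ.≤-Reasoning

𝟙*-≤ : ∀ b x y {r} → 0ℚ ≤ℚ r → (b ≡ true → toℚ x ≤ℚ r +ℚ toℚ y) → toℚ (𝟙 b * x) ≤ℚ r +ℚ toℚ (𝟙 b * y)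
𝟙*-≤ true  x y {r} _ x≤ = subst₂ (λ a b → toℚ a ≤ℚ r +ℚ toℚ b) (sym (*-identityˡ x)) (sym (*-identityˡ y)) (x≤ refl)
𝟙*-≤ false x y {r} 0≤r _ = ℚ.≤-trans 0≤r (ℚ.≤-reflexive (sym (ℚ.+-identityʳ r)))

≤-from-lower-bound : ∀ {a d c b h} {r : ℚ} → a + d + c ≤ b + h → toℚ b -ℚ toℚ c -ℚ r ≤ℚ toℚ d →
                     toℚ a ≤ℚ r +ℚ toℚ h
≤-from-lower-bound {a} {d} {c} {b} {h} {r} a+d+c≤b+h b-c-r≤d = begin
  toℚ a
    ≡⟨ solve 3 (λ a d c → a := (a :+ d :+ c) :- d :- c) refl (toℚ a) (toℚ d) (toℚ c) ⟩
  (toℚ a +ℚ toℚ d +ℚ toℚ c) -ℚ toℚ d -ℚ toℚ c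
    ≡⟨ cong (λ x → x -ℚ toℚ d -ℚ toℚ c) (trans (toℚ-+ (a + d) c) (cong (_+ℚ toℚ c) (toℚ-+ a d))) ⟨
  toℚ (a + d + c) -ℚ toℚ d -ℚ toℚ c
    ≤⟨ ℚ.+-monoˡ-≤ (-ℚ toℚ c) (ℚ.+-mono-≤ (toℚ-mono-≤ a+d+c≤b+h) (ℚ.neg-antimono-≤ b-c-r≤d)) ⟩
  toℚ (b + h) -ℚ (toℚ b -ℚ toℚ c -ℚ r) -ℚ toℚ c
    ≡⟨ cong (λ x → x -ℚ (toℚ b -ℚ toℚ c -ℚ r) -ℚ toℚ c) (toℚ-+ b h) ⟩
  (toℚ b +ℚ toℚ h) -ℚ (toℚ b -ℚ toℚ c -ℚ r) -ℚ toℚ c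
    ≡⟨ solve 4 (λ b h c r → (b :+ h) :- (b :- c :- r) :- c := r :+ h) refl (toℚ b) (toℚ h) (toℚ c) r ⟩
  r +ℚ toℚ h ∎
  where open ℚ.≤-Reasoning

toℚ≤/ : ∀ c x y .{{_ : NonZero y}} → c * y ≤ x → toℚ c ≤ℚ (ℤ.+ x) / y
toℚ≤/ c x (suc y-1) cy≤x rewrite toℚ≡mkℚ c =
  ℚ.toℚᵘ-cancel-≤ (ℚᵘ.≤-respʳ-≃ (ℚᵘ.≃-sym (ℚ.toℚᵘ-fromℚᵘ (ℚᵘ.mkℚᵘ (ℤ.+ x) y-1)))
    (ℚᵘ.*≤* (subst₂ ℤ._≤_ (ℤ.pos-* c (suc y-1)) (sym (ℤ.*-identityʳ (ℤ.+ x))) (ℤ.+≤+ cy≤x))))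

c≤ε*n : ∀ c ε → 0ℚ <ℚ ε → ∀ n → c * ↧ₙ ε ≤ n → toℚ c ≤ℚ ε *ℚ toℚ n
c≤ε*n c (mkℚ (ℤ.+ suc p) d-1 _) _ n cd≤n rewrite toℚ≡mkℚ n =
  -- ε *ℚ toℚ n now unfolds to (ℤ.+ (suc p) ℤ.* ℤ.+ n) / (suc d-1 * 1).
  subst (λ x → toℚ c ≤ℚ x / (suc d-1 * 1)) (ℤ.pos-* (suc p) n)
    (toℚ≤/ c (suc p * n) (suc d-1 * 1)
      (begin
        c * (suc d-1 * 1) ≡⟨ cong (c *_) (*-identityʳ (suc d-1)) ⟩
        c * suc d-1       ≤⟨ cd≤n ⟩
        n                 ≤⟨ m≤n*m n (suc p) ⟩
        suc p * n         ∎))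
  where open ≤-Reasoning
c≤ε*n c (mkℚ (ℤ.+ zero) _ _) (*<* (ℤ.+<+ ())) n _
c≤ε*n c (mkℚ ℤ.-[1+ _ ] _ _) (*<* ()) n _

few-missing-arithmetic :
  ∀ {X ε ϱ N P K E D C : ℚ} → 0ℚ ≤ℚ N → 0ℚ ≤ℚ P → 0ℚ ≤ℚ E → 0ℚ ≤ℚ D → 0ℚ <ℚ ε →
  X ≤ℚ N *ℚ (ϱ *ℚ P) +ℚ K *ℚ (E +ℚ D *ℚ C) →
  ϱ *ℚ toℚ 12 <ℚ ε →
  toℚ 2 *ℚ K *ℚ K *ℚ E <ℚ ε *ℚ (N *ℚ P) →
  toℚ 2 *ℚ K *ℚ C ≤ℚ toℚ 3 *ℚ P →
  D ≤ℚ ε *ℚ (ℤ.+ 1 / 7) *ℚ N +ℚ 1ℚ →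
  toℚ 3 ≤ℚ ε *ℚ N →
  toℚ 3 ≤ℚ K →
  X ≤ℚ ε *ℚ (N *ℚ P)
few-missing-arithmetic {X} {ε} {ϱ} {N} {P} {K} {E} {D} {C}
  0≤N 0≤P 0≤E 0≤D 0<ε X≤ 12ϱ<ε 2KKE<Q 2KC≤3P D≤ 3≤εN 3≤K = begin
  X
    ≤⟨ X≤ ⟩
  N *ℚ (ϱ *ℚ P) +ℚ K *ℚ (E +ℚ D *ℚ C)
    ≡⟨ solve 6 (λ N ϱP K E D C → N :* ϱP :+ K :* (E :+ D :* C) := N :* ϱP :+ (K :* E :+ K :* (D :* C)))
               refl N (ϱ *ℚ P) K E D C ⟩
  N *ℚ (ϱ *ℚ P) +ℚ (K *ℚ E +ℚ K *ℚ (D *ℚ C))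
    ≤⟨ ℚ.+-mono-≤ ϱ-term (ℚ.+-mono-≤ E-term D-term) ⟩
  (ℤ.+ 1 / 12) *ℚ Q +ℚ ((ℤ.+ 1 / 6) *ℚ Q +ℚ (ℤ.+ 5 / 7) *ℚ Q)
    ≡⟨ solve 1 (λ Q → con (ℤ.+ 1 / 12) :* Q :+ (con (ℤ.+ 1 / 6) :* Q :+ con (ℤ.+ 5 / 7) :* Q) := con (ℤ.+ 27 / 28) :* Q)
               refl Q ⟩
  (ℤ.+ 27 / 28) *ℚ Q
    ≤⟨ ℚ.*-monoʳ-≤-nonNeg Q {{nonNegative 0≤Q}} {ℤ.+ 27 / 28} {1ℚ} (*≤* (ℤ.+≤+ (n≤1+n 27))) ⟩
  1ℚ *ℚ Q
    ≡⟨ ℚ.*-identityˡ Q ⟩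
  Q ∎
  where
  open ℚ.≤-Reasoning
  Q = ε *ℚ (N *ℚ P)
  mulˡ : ∀ {r p q} → 0ℚ ≤ℚ r → p ≤ℚ q → r *ℚ p ≤ℚ r *ℚ q
  mulˡ {r} 0≤r = ℚ.*-monoˡ-≤-nonNeg r {{nonNegative 0≤r}}
  0≤NP = nonNeg-* 0≤N 0≤P
  0≤Q = nonNeg-* (ℚ.<⇒≤ 0<ε) 0≤NP
  0≤K = ℚ.≤-trans (toℚ-nonNeg 3) 3≤K
  ϱ-term : N *ℚ (ϱ *ℚ P) ≤ℚ (ℤ.+ 1 / 12) *ℚ Q
  ϱ-term = begin
    N *ℚ (ϱ *ℚ P)
      ≡⟨ solve 3 (λ N ϱ P → N :* (ϱ :* P) := (con (ℤ.+ 1 / 12) :* (N :* P)) :* (ϱ :* con (toℚ 12))) refl N ϱ P ⟩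
    ((ℤ.+ 1 / 12) *ℚ (N *ℚ P)) *ℚ (ϱ *ℚ toℚ 12)
      ≤⟨ mulˡ (nonNeg-* (0≤/ 1 12) 0≤NP) (ℚ.<⇒≤ 12ϱ<ε) ⟩
    ((ℤ.+ 1 / 12) *ℚ (N *ℚ P)) *ℚ ε
      ≡⟨ solve 3 (λ N P ε → (con (ℤ.+ 1 / 12) :* (N :* P)) :* ε := con (ℤ.+ 1 / 12) :* (ε :* (N :* P))) refl N P ε ⟩
    (ℤ.+ 1 / 12) *ℚ Q ∎
  E-term : K *ℚ E ≤ℚ (ℤ.+ 1 / 6) *ℚ Q
  E-term = begin
    K *ℚ E
      ≡⟨ solve 2 (λ K E → K :* E := con (ℤ.+ 1 / 6) :* ((con (toℚ 2) :* K :* E) :* con (toℚ 3))) refl K E ⟩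
    (ℤ.+ 1 / 6) *ℚ ((toℚ 2 *ℚ K *ℚ E) *ℚ toℚ 3)
      ≤⟨ mulˡ (0≤/ 1 6) (mulˡ (nonNeg-* (nonNeg-* (toℚ-nonNeg 2) 0≤K) 0≤E) 3≤K) ⟩
    (ℤ.+ 1 / 6) *ℚ ((toℚ 2 *ℚ K *ℚ E) *ℚ K)
      ≡⟨ cong ((ℤ.+ 1 / 6) *ℚ_) (solve 2 (λ K E → (con (toℚ 2) :* K :* E) :* K := con (toℚ 2) :* K :* K :* E) refl K E) ⟩
    (ℤ.+ 1 / 6) *ℚ (toℚ 2 *ℚ K *ℚ K *ℚ E)
      ≤⟨ mulˡ (0≤/ 1 6) (ℚ.<⇒≤ 2KKE<Q) ⟩
    (ℤ.+ 1 / 6) *ℚ Q ∎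
  D-term : K *ℚ (D *ℚ C) ≤ℚ (ℤ.+ 5 / 7) *ℚ Q
  D-term = begin
    K *ℚ (D *ℚ C)
      ≡⟨ solve 3 (λ K D C → K :* (D :* C) := (con (ℤ.+ 1 / 2) :* D) :* (con (toℚ 2) :* K :* C)) refl K D C ⟩
    ((ℤ.+ 1 / 2) *ℚ D) *ℚ (toℚ 2 *ℚ K *ℚ C)
      ≤⟨ mulˡ (nonNeg-* (0≤/ 1 2) 0≤D) 2KC≤3P ⟩
    ((ℤ.+ 1 / 2) *ℚ D) *ℚ (toℚ 3 *ℚ P)
      ≡⟨ solve 2 (λ D P → (con (ℤ.+ 1 / 2) :* D) :* (con (toℚ 3) :* P) := (con (ℤ.+ 3 / 2) :* P) :* D) refl D P ⟩
    ((ℤ.+ 3 / 2) *ℚ P) *ℚ D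
      ≤⟨ mulˡ (nonNeg-* (0≤/ 3 2) 0≤P) D≤ ⟩
    ((ℤ.+ 3 / 2) *ℚ P) *ℚ (ε *ℚ (ℤ.+ 1 / 7) *ℚ N +ℚ 1ℚ)
      ≡⟨ solve 3 (λ P ε N → (con (ℤ.+ 3 / 2) :* P) :* (ε :* con (ℤ.+ 1 / 7) :* N :+ con 1ℚ)
                           := con (ℤ.+ 3 / 14) :* (ε :* (N :* P)) :+ (con (ℤ.+ 1 / 2) :* P) :* con (toℚ 3))
                 refl P ε N ⟩
    (ℤ.+ 3 / 14) *ℚ Q +ℚ ((ℤ.+ 1 / 2) *ℚ P) *ℚ toℚ 3
      ≤⟨ ℚ.+-monoʳ-≤ ((ℤ.+ 3 / 14) *ℚ Q) (mulˡ (nonNeg-* (0≤/ 1 2) 0≤P) 3≤εN) ⟩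
    (ℤ.+ 3 / 14) *ℚ Q +ℚ ((ℤ.+ 1 / 2) *ℚ P) *ℚ (ε *ℚ N)
      ≡⟨ solve 3 (λ P ε N → con (ℤ.+ 3 / 14) :* (ε :* (N :* P)) :+ (con (ℤ.+ 1 / 2) :* P) :* (ε :* N)
                           := con (ℤ.+ 5 / 7) :* (ε :* (N :* P)))
                 refl P ε N ⟩
    (ℤ.+ 5 / 7) *ℚ Q ∎

-- Missing edges of H_{k,k−1}(V ∖ W, W)

≡ᵇ⇒≡ : ∀ {a b} → (a ≡ᵇ b) ≡ true → a ≡ b
≡ᵇ⇒≡ {zero}  {zero}  _ = refl
≡ᵇ⇒≡ {suc a} {suc b} p = cong suc (≡ᵇ⇒≡ p)

≡⇒≡ᵇ : ∀ {a b} → a ≡ b → (a ≡ᵇ b) ≡ true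
≡⇒≡ᵇ {zero}  refl = refl
≡⇒≡ᵇ {suc a} refl = ≡⇒≡ᵇ {a} refl

∧-intro : ∀ {a b} → a ≡ true → b ≡ true → a ∧ b ≡ true
∧-intro = cong₂ _∧_

module _ {k₁ n} (H : KGraph (suc k₁) n) (W : Subset n) where

  hasSize : Subset n → Bool
  hasSize e = ∣ e ∣ ≡ᵇ suc k₁

  edge⇒hasSize : ∀ e → edge H e ≡ true → hasSize e ≡ true
  edge⇒hasSize e = ≡⇒≡ᵇ ∘ uniform H e

  missingEdge : Subset n → Bool
  missingEdge e = HkEdge (suc k₁) W e ∧ not (edge H e)

  avoidingEdge : Subset n → Bool
  avoidingEdge e = edge H e ∧ not (meets W e)

  missing≤incidences : missing H W ≤ incidences (∁ W) missingEdge
  missing≤incidences = count≤incidences (∁ W) missingEdge meets∁W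
    where
    meets∁W : ∀ e → missingEdge e ≡ true → 1 ≤ ∣ e ∩ ∁ W ∣
    meets∁W e p = +-cancelˡ-≤ ∣ e ∩ W ∣ 1 ∣ e ∩ ∁ W ∣ (begin
      ∣ e ∩ W ∣ + 1               ≤⟨ +-monoˡ-≤ 1 ∣e∩W∣≤k₁ ⟩
      k₁ + 1                      ≡⟨ +-comm k₁ 1 ⟩
      suc k₁                      ≡⟨ ≡ᵇ⇒≡ (∧-conicalˡ (hasSize e) _ Hk) ⟨
      ∣ e ∣                       ≡⟨ ∣∩∣+∣∩∁∣≡∣∣ e W ⟨
      ∣ e ∩ W ∣ + ∣ e ∩ ∁ W ∣     ∎)
      where
      open ≤-Reasoning
      Hk = ∧-conicalˡ (HkEdge (suc k₁) W e) _ p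
      ∣e∩W∣≤k₁ : ∣ e ∩ W ∣ ≤ k₁
      ∣e∩W∣≤k₁ = ≤ᵇ⇒≤ _ _ (Equivalence.from T-≡ (∧-conicalʳ (meets W e) _ (∧-conicalʳ (hasSize e) _ Hk)))

  module _ (v : Fin n) (v∉W : lookup (∁ W) v ≡ true) where

    private
      through : (Subset n → Bool) → Subset n → Bool
      through P e = P e ∧ lookup e v
      K = through hasSize
      M = meets W
      meetingNonEdges = count (λ e → (K e ∧ M e) ∧ not (edge H e))
      meetingEdges = count (λ e → (K e ∧ M e) ∧ edge H e)
      avoidingSets = count (λ e → K e ∧ not (M e))

    missing-through≤ : count (through missingEdge) ≤ meetingNonEdges
    missing-through≤ = count-mono λ e p →
      let Hk = ∧-conicalˡ (HkEdge (suc k₁) W e) _ (∧-conicalˡ (missingEdge e) _ p) in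
      ∧-intro (∧-intro (∧-intro (∧-conicalˡ (hasSize e) _ Hk) (∧-conicalʳ (missingEdge e) _ p))
                       (∧-conicalˡ (M e) _ (∧-conicalʳ (hasSize e) _ Hk)))
              (∧-conicalʳ (HkEdge (suc k₁) W e) _ (∧-conicalˡ (missingEdge e) _ p))

    deg≤ : deg H v ≤ meetingEdges + count (through avoidingEdge)
    deg≤ = begin
      deg H v
        ≡⟨ count-split (through (edge H)) M ⟩
      count (λ e → through (edge H) e ∧ M e) + count (λ e → through (edge H) e ∧ not (M e))
        ≤⟨ +-mono-≤ (count-mono meeting) (count-mono avoiding) ⟩
      meetingEdges + count (through avoidingEdge) ∎
      where
      open ≤-Reasoning
      meeting : ∀ e → through (edge H) e ∧ M e ≡ true → (K e ∧ M e) ∧ edge H e ≡ true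
      meeting e p = let h = ∧-conicalˡ (edge H e) _ (∧-conicalˡ (through (edge H) e) _ p) in
        ∧-intro (∧-intro (∧-intro (edge⇒hasSize e h) (∧-conicalʳ (edge H e) _ (∧-conicalˡ (through (edge H) e) _ p)))
                         (∧-conicalʳ (through (edge H) e) _ p))
                h
      avoiding : ∀ e → through (edge H) e ∧ not (M e) ≡ true → through avoidingEdge e ≡ true
      avoiding e p = let q = ∧-conicalˡ (through (edge H) e) _ p in
        ∧-intro (∧-intro (∧-conicalˡ (edge H e) _ q) (∧-conicalʳ (through (edge H) e) _ p)) (∧-conicalʳ (edge H e) _ q)

    avoidingSets≡ : avoidingSets ≡ (∣ ∁ W ∣ ∸ 1) C k₁
    avoidingSets≡ = trans (count-cong (λ e → cong (K e ∧_) (not-meets≡⊆ᵇ∁ W e))) (count-∋-⊆-size≡C (∁ W) v v∉W k₁)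

    C≡meeting+avoiding : (n ∸ 1) C k₁ ≡ (meetingEdges + meetingNonEdges) + avoidingSets
    C≡meeting+avoiding = begin
      (n ∸ 1) C k₁                                      ≡⟨ count-∋-size≡C v k₁ ⟨
      count K                                           ≡⟨ count-split K M ⟩
      count (λ e → K e ∧ M e) + avoidingSets            ≡⟨ cong (_+ avoidingSets) (count-split (λ e → K e ∧ M e) (edge H)) ⟩
      (meetingEdges + meetingNonEdges) + avoidingSets   ∎
      where open ≡-Reasoning

    missing+deg+C≤ : count (through missingEdge) + deg H v + (∣ ∁ W ∣ ∸ 1) C k₁
                     ≤ (n ∸ 1) C k₁ + count (through avoidingEdge)
    missing+deg+C≤ = begin
      count (through missingEdge) + deg H v + (∣ ∁ W ∣ ∸ 1) C k₁
        ≤⟨ +-mono-≤ (+-mono-≤ missing-through≤ deg≤) (≤-reflexive (sym avoidingSets≡)) ⟩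
      meetingNonEdges + (meetingEdges + count (through avoidingEdge)) + avoidingSets
        ≡⟨ rearrange meetingNonEdges meetingEdges (count (through avoidingEdge)) avoidingSets ⟩
      (meetingEdges + meetingNonEdges) + avoidingSets + count (through avoidingEdge)
        ≡⟨ cong (_+ count (through avoidingEdge)) C≡meeting+avoiding ⟨
      (n ∸ 1) C k₁ + count (through avoidingEdge) ∎
      where
      open ≤-Reasoning
      rearrange : ∀ a b c d → a + (b + c) + d ≡ (b + a) + d + c
      rearrange = solve-∀

  incidences-avoiding≤ : incidences (∁ W) avoidingEdge ≤ suc k₁ * count avoidingEdge
  incidences-avoiding≤ = incidences≤*count (∁ W) avoidingEdge (suc k₁) λ e p →
    subst (∣ e ∩ ∁ W ∣ ≤_) (uniform H e (∧-conicalˡ (edge H e) _ p)) (∣∩∣≤∣∣ e (∁ W))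

  count-avoiding≤ : ∀ S → count avoidingEdge ≤ eInduced H S + ∣ ∁ S ∩ ∁ W ∣ * ((n ∸ 1) C k₁)
  count-avoiding≤ S = begin
    count avoidingEdge
      ≡⟨ count-split avoidingEdge (_⊆ᵇ S) ⟩
    count (λ e → avoidingEdge e ∧ (e ⊆ᵇ S)) + count (λ e → avoidingEdge e ∧ not (e ⊆ᵇ S))
      ≤⟨ +-mono-≤ (count-mono inside) (count-mono leaving) ⟩
    eInduced H S + count (λ e → hasSize e ∧ meets D e)
      ≤⟨ +-monoʳ-≤ (eInduced H S) (count≤incidences D _ λ e p → meets⇒1≤∣∩∣ D e (∧-conicalʳ (hasSize e) _ p)) ⟩
    eInduced H S + incidences D (λ e → hasSize e ∧ meets D e)
      ≤⟨ +-monoʳ-≤ (eInduced H S) (∑-mono-≤ through≤) ⟩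
    eInduced H S + ∑[ v < n ] (𝟙 (lookup D v) * ((n ∸ 1) C k₁))
      ≡⟨ cong (eInduced H S +_) (∑𝟙*≡∣∣* D _) ⟩
    eInduced H S + ∣ D ∣ * ((n ∸ 1) C k₁) ∎
    where
    open ≤-Reasoning
    D = ∁ S ∩ ∁ W
    inside : ∀ e → avoidingEdge e ∧ (e ⊆ᵇ S) ≡ true → edge H e ∧ (e ⊆ᵇ S) ≡ true
    inside e p = ∧-intro (∧-conicalˡ (edge H e) _ (∧-conicalˡ (avoidingEdge e) _ p)) (∧-conicalʳ (avoidingEdge e) _ p)
    leaving : ∀ e → avoidingEdge e ∧ not (e ⊆ᵇ S) ≡ true → hasSize e ∧ meets D e ≡ true
    leaving e p = ∧-intro (edge⇒hasSize e (∧-conicalˡ (edge H e) _ avoiding))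
                          (⊆ᵇ∧⊈ᵇ⇒meets-∖ e S (∁ W) (trans (sym (not-meets≡⊆ᵇ∁ W e)) (∧-conicalʳ (edge H e) _ avoiding))
                                                  (not-injective {e ⊆ᵇ S} {false} (∧-conicalʳ (avoidingEdge e) _ p)))
      where avoiding = ∧-conicalˡ (avoidingEdge e) _ p
    through≤ : ∀ v → 𝟙 (lookup D v) * count (λ e → (hasSize e ∧ meets D e) ∧ lookup e v) ≤ 𝟙 (lookup D v) * ((n ∸ 1) C k₁)
    through≤ v = *-monoʳ-≤ (𝟙 (lookup D v)) (begin
      count (λ e → (hasSize e ∧ meets D e) ∧ lookup e v)
        ≤⟨ count-mono (λ e p → ∧-intro (∧-conicalˡ (hasSize e) _ (∧-conicalˡ (hasSize e ∧ meets D e) _ p))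
                                        (∧-conicalʳ (hasSize e ∧ meets D e) _ p)) ⟩
      count (λ e → hasSize e ∧ lookup e v)
        ≡⟨ count-∋-size≡C v k₁ ⟩
      (n ∸ 1) C k₁ ∎)

  missing≤ : ∀ S (r : ℚ) → 0ℚ ≤ℚ r → δ₁≥ H (toℚ ((n ∸ 1) C k₁) -ℚ toℚ ((∣ ∁ W ∣ ∸ 1) C k₁) -ℚ r) →
             toℚ (missing H W) ≤ℚ toℚ n *ℚ r +ℚ toℚ (suc k₁ * (eInduced H S + ∣ ∁ S ∩ ∁ W ∣ * ((n ∸ 1) C k₁)))
  missing≤ S r 0≤r δ = begin
    toℚ (missing H W)
      ≤⟨ toℚ-mono-≤ missing≤incidences ⟩
    toℚ (incidences (∁ W) missingEdge)
      ≤⟨ toℚ-∑-≤ r (summand missingEdge) (summand avoidingEdge) per-vertex ⟩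
    toℚ n *ℚ r +ℚ toℚ (incidences (∁ W) avoidingEdge)
      ≤⟨ ℚ.+-monoʳ-≤ (toℚ n *ℚ r) (toℚ-mono-≤ (≤-trans incidences-avoiding≤ (*-monoʳ-≤ (suc k₁) (count-avoiding≤ S)))) ⟩
    toℚ n *ℚ r +ℚ toℚ (suc k₁ * (eInduced H S + ∣ ∁ S ∩ ∁ W ∣ * ((n ∸ 1) C k₁))) ∎
    where
    open ℚ.≤-Reasoning
    summand : (Subset n → Bool) → Fin n → ℕ
    summand P v = 𝟙 (lookup (∁ W) v) * count (λ e → P e ∧ lookup e v)
    per-vertex : ∀ v → toℚ (summand missingEdge v) ≤ℚ r +ℚ toℚ (summand avoidingEdge v)
    per-vertex v =
      𝟙*-≤ (lookup (∁ W) v) (count (λ e → missingEdge e ∧ lookup e v)) (count (λ e → avoidingEdge e ∧ lookup e v)) 0≤r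
        λ v∉W → ≤-from-lower-bound {d = deg H v} {(∣ ∁ W ∣ ∸ 1) C k₁} {(n ∸ 1) C k₁} {r = r}
                                   (missing+deg+C≤ v v∉W) (δ v)

∣∁∣∸1≡n∸m : ∀ {n m} (W : Subset n) → ∣ W ∣ ≡ m ∸ 1 → 1 ≤ m → ∣ ∁ W ∣ ∸ 1 ≡ n ∸ m
∣∁∣∸1≡n∸m {n} {m} W ∣W∣≡m∸1 1≤m = begin
  ∣ ∁ W ∣ ∸ 1               ≡⟨ cong (_∸ 1) (m+n∸m≡n ∣ W ∣ ∣ ∁ W ∣) ⟨
  ∣ W ∣ + ∣ ∁ W ∣ ∸ ∣ W ∣ ∸ 1 ≡⟨ cong₂ (λ x y → x ∸ y ∸ 1) (∣∣+∣∁∣≡n W) ∣W∣≡m∸1 ⟩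
  n ∸ (m ∸ 1) ∸ 1           ≡⟨ ∸-+-assoc n (m ∸ 1) 1 ⟩
  n ∸ (m ∸ 1 + 1)           ≡⟨ cong (n ∸_) (m∸n+n≡m 1≤m) ⟩
  n ∸ m                     ∎
  where open ≡-Reasoning

≤∸[m∸1]⇒≤+1 : ∀ {d s t n m} (f : ℚ) → 0ℚ ≤ℚ f → 1 ≤ m → s + t ≡ n → d ≤ t ∸ (m ∸ 1) →
              toℚ n -ℚ toℚ m -ℚ f ≤ℚ toℚ s → toℚ d ≤ℚ f +ℚ 1ℚ
≤∸[m∸1]⇒≤+1 {zero}                f 0≤f _   _     _   _ = ℚ.≤-trans 0≤f (ℚ.≤-trans (ℚ.≤-reflexive (sym (ℚ.+-identityʳ f))) (ℚ.+-monoʳ-≤ f (toℚ-nonNeg 1)))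
≤∸[m∸1]⇒≤+1 {suc d} {s} {t} {n} {m} f _ 1≤m s+t≡n d≤t∸j n-m-f≤s = ≤-from-lower-bound {suc d} {s} {m} {n} {1} {f} (begin
  suc d + s + m                 ≡⟨ cong (suc d + s +_) (m∸n+n≡m 1≤m) ⟨
  suc d + s + (m ∸ 1 + 1)       ≡⟨ regroup (suc d) s (m ∸ 1) ⟩
  suc d + (m ∸ 1) + s + 1       ≤⟨ +-monoˡ-≤ 1 (+-monoˡ-≤ s (m≤o∸n⇒m+n≤o (suc d) j≤t d≤t∸j)) ⟩
  t + s + 1                     ≡⟨ cong (_+ 1) (trans (+-comm t s) s+t≡n) ⟩
  n + 1                         ∎) n-m-f≤s
  where
  open ≤-Reasoning
  regroup : ∀ a b c → a + b + (c + 1) ≡ a + c + b + 1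
  regroup = solve-∀
  j≤t : m ∸ 1 ≤ t
  j≤t = <⇒≤ (m∸n≢0⇒n<m λ t∸j≡0 → contradiction (subst (suc d ≤_) t∸j≡0 d≤t∸j) λ ())

sparse⇒εContains : ∀ {k₂ n} (H : KGraph (3 + k₂) n) (W S : Subset n) {ε ϱ : ℚ} →
  0ℚ <ℚ ε → 0ℚ <ℚ ϱ → ϱ *ℚ toℚ 12 <ℚ ε → toℚ 3 ≤ℚ ε *ℚ toℚ n →
  δ₁≥ H (toℚ ((n ∸ 1) C (2 + k₂)) -ℚ toℚ ((∣ ∁ W ∣ ∸ 1) C (2 + k₂)) -ℚ ϱ *ℚ toℚ (n ^ (2 + k₂))) →
  toℚ ∣ ∁ S ∩ ∁ W ∣ ≤ℚ ε *ℚ (ℤ.+ 1 / 7) *ℚ toℚ n +ℚ 1ℚ →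
  toℚ (2 * (3 + k₂) ^ 2) *ℚ toℚ (eInduced H S) <ℚ ε *ℚ toℚ (n ^ (3 + k₂)) →
  εContainsHkk-1 ε H W
sparse⇒εContains {k₂} {n} H W S {ε} {ϱ} 0<ε 0<ϱ 12ϱ<ε 3≤εn δ D≤ sparse =
  subst (λ x → toℚ (missing H W) ≤ℚ ε *ℚ x) (sym NP≡)
    (few-missing-arithmetic {toℚ (missing H W)} {ε} {ϱ} {toℚ n} {toℚ (n ^ k₁)} {toℚ k} {toℚ (eInduced H S)} {toℚ ∣ D ∣} {toℚ c}
      (toℚ-nonNeg n) (toℚ-nonNeg (n ^ k₁)) (toℚ-nonNeg (eInduced H S)) (toℚ-nonNeg ∣ D ∣) 0<ε
      (subst (λ x → toℚ (missing H W) ≤ℚ toℚ n *ℚ (ϱ *ℚ toℚ (n ^ k₁)) +ℚ x) k*[e+d*c]≡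
         (missing≤ H W S (ϱ *ℚ toℚ (n ^ k₁)) (nonNeg-* (ℚ.<⇒≤ 0<ϱ) (toℚ-nonNeg (n ^ k₁))) δ))
      12ϱ<ε
      (subst₂ _<ℚ_ (cong (_*ℚ toℚ (eInduced H S)) 2k²≡) (cong (ε *ℚ_) NP≡) sparse)
      (subst₂ _≤ℚ_ 2kc≡ (toℚ-* 3 (n ^ k₁)) (toℚ-mono-≤ (2k*C≤3*n^[k-1] k₂ n)))
      D≤ 3≤εn (toℚ-mono-≤ (m≤m+n 3 k₂)))
  where
  k₁ = 2 + k₂
  k = 3 + k₂
  D = ∁ S ∩ ∁ W
  c = (n ∸ 1) C k₁
  NP≡ : toℚ (n ^ k) ≡ toℚ n *ℚ toℚ (n ^ k₁)
  NP≡ = toℚ-* n (n ^ k₁)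
  2k²≡ : toℚ (2 * k ^ 2) ≡ toℚ 2 *ℚ toℚ k *ℚ toℚ k
  2k²≡ = begin
    toℚ (2 * k ^ 2)             ≡⟨ cong toℚ (trans (cong (λ x → 2 * (k * x)) (*-identityʳ k)) (sym (*-assoc 2 k k))) ⟩
    toℚ (2 * k * k)             ≡⟨ toℚ-* (2 * k) k ⟩
    toℚ (2 * k) *ℚ toℚ k        ≡⟨ cong (_*ℚ toℚ k) (toℚ-* 2 k) ⟩
    toℚ 2 *ℚ toℚ k *ℚ toℚ k     ∎
    where open ≡-Reasoning
  2kc≡ : toℚ (2 * k * c) ≡ toℚ 2 *ℚ toℚ k *ℚ toℚ c
  2kc≡ = trans (toℚ-* (2 * k) c) (cong (_*ℚ toℚ c) (toℚ-* 2 k))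
  k*[e+d*c]≡ : toℚ (k * (eInduced H S + ∣ D ∣ * c)) ≡ toℚ k *ℚ (toℚ (eInduced H S) +ℚ toℚ ∣ D ∣ *ℚ toℚ c)
  k*[e+d*c]≡ = begin
    toℚ (k * (eInduced H S + ∣ D ∣ * c))                      ≡⟨ toℚ-* k (eInduced H S + ∣ D ∣ * c) ⟩
    toℚ k *ℚ toℚ (eInduced H S + ∣ D ∣ * c)                   ≡⟨ cong (toℚ k *ℚ_) (toℚ-+ (eInduced H S) (∣ D ∣ * c)) ⟩
    toℚ k *ℚ (toℚ (eInduced H S) +ℚ toℚ (∣ D ∣ * c))          ≡⟨ cong (λ x → toℚ k *ℚ (toℚ (eInduced H S) +ℚ x)) (toℚ-* ∣ D ∣ c) ⟩
    toℚ k *ℚ (toℚ (eInduced H S) +ℚ toℚ ∣ D ∣ *ℚ toℚ c)       ∎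
    where open ≡-Reasoning

-- Imported only here: in scope earlier, the prefix +_ would make sections such as (a +_) ambiguous.
open import Data.Integer using (+_)

lemma3p4 : (k : ℕ) → 3 ≤ k → (ε ϱ : ℚ) → 0ℚ <ℚ ε → ε *ℚ toℚ k <ℚ 1ℚ → 0ℚ <ℚ ϱ → ϱ *ℚ toℚ 12 <ℚ ε →
  Σ ℕ (λ n₀ → (n m : ℕ) → n₀ ≤ n → n ≤ 2 * k ^ 4 * m → m * k < n →
    (H : KGraph k n) →
    δ₁≥ H (toℚ ((n ∸ 1) C (k ∸ 1)) -ℚ toℚ ((n ∸ m) C (k ∸ 1)) -ℚ ϱ *ℚ toℚ (n ^ (k ∸ 1))) →
    ¬ εContainsHk ε H m →
    (S : Subset n) → toℚ n -ℚ toℚ m -ℚ ε *ℚ (+ 1 / 7) *ℚ toℚ n ≤ℚ toℚ ∣ S ∣ →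
    ε *ℚ toℚ (n ^ k) ≤ℚ toℚ (2 * k ^ 2) *ℚ toℚ (eInduced H S))
lemma3p4 k@(suc (suc (suc k₂))) (s≤s (s≤s (s≤s z≤n))) ε ϱ 0<ε _ 0<ϱ 12ϱ<ε =
  3 * ↧ₙ ε , λ n m n₀≤n n≤2k⁴m mk<n H δ H≉ S |S|≥ →
  -- n₀ = 3 · (denominator of ε) gives εn ≥ 3.
  let 3≤n = ≤-trans (m≤m*n 3 (↧ₙ ε)) n₀≤n
      1≤m = n≢0⇒n>0 λ m≡0 →
              contradiction (≤-trans 3≤n (subst (n ≤_) (trans (cong (2 * k ^ 4 *_) m≡0) (*-zeroʳ (2 * k ^ 4))) n≤2k⁴m)) λ ()
      m≤n = ≤-trans (m≤m*n m k) (<⇒≤ mk<n)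
      (W , ∣W∣≡m∸1 , ∣∁S∖W∣≤) = covering-subset (∁ S) (m ∸ 1) (≤-trans (m∸n≤m m 1) m≤n)
      δ′ = subst (λ x → δ₁≥ H (toℚ ((n ∸ 1) C (k ∸ 1)) -ℚ toℚ (x C (k ∸ 1)) -ℚ ϱ *ℚ toℚ (n ^ (k ∸ 1))))
                 (sym (∣∁∣∸1≡n∸m W ∣W∣≡m∸1 1≤m)) δ
      0≤εn/7 = nonNeg-* (nonNeg-* (ℚ.<⇒≤ 0<ε) (0≤/ 1 7)) (toℚ-nonNeg n)
      D≤ = ≤∸[m∸1]⇒≤+1 {∣ ∁ S ∩ ∁ W ∣} {∣ S ∣} {∣ ∁ S ∣} {n} {m} (ε *ℚ (+ 1 / 7) *ℚ toℚ n) 0≤εn/7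
                       1≤m (∣∣+∣∁∣≡n S) ∣∁S∖W∣≤ |S|≥
  in decidable-stable (ε *ℚ toℚ (n ^ k) ℚ.≤? toℚ (2 * k ^ 2) *ℚ toℚ (eInduced H S)) λ not-dense →
       H≉ (W , ∣W∣≡m∸1 , sparse⇒εContains H W S {ε} {ϱ} 0<ε 0<ϱ 12ϱ<ε (c≤ε*n 3 ε 0<ε n n₀≤n) δ′ D≤ (ℚ.≰⇒> not-dense))
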